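{- Let $n \geq 8$ be an integer, let $m = \lfloor n/8 \rfloor$ and $\bar r = n \bmod 8$. Then the mixed domination number of the generalized Petersen graph $P(n,1)$ is $$\gamma_{md}(P(n,1)) = \begin{cases} 6m & \text{if } \bar r = 0,\\ 6m+2 & \text{if } \bar r \in \{1,2\},\\ 6m+3 & \text{if } \bar r = 3,\\ 6m+4 & \text{if } \bar r \in \{4,5\},\\ 6m+5 & \text{if } \bar r = 6,\\ 6m+6 & \text{if } \bar r = 7.\end{cases}$$
   Context: For integers $n$ and $k$ with $1 \le k \le n/2$, the generalized Petersen graph $P(n,k)$ has vertex set $\{v_i, u_i : 0 \le i \le n-1\}$ and edge set $\{v_i v_{(i+1) \bmod n},\ v_i u_i,\ u_i u_{(i+k) \bmod n} : 0 \le i \le n-1\}$. For a graph $G=(V,E)$, a set $S \subseteq V \cup E$ is a mixed dominating set if every element of $(V \cup E)\setminus S$ is adjacent or incident to some element of $S$ (vertices are adjacent if joined by an edge, edges are adjacent if they share an endpoint, and a vertex and an edge are incident if the vertex is an endpoint of the edge). The mixed domination number $\gamma_{md}(G)$ is the minimum size of a mixed dominating set of $G$. -}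

module Defs where

open import Data.Nat using (ℕ; zero; suc; _+_; _*_; _≤_)
open import Data.Nat.DivMod using (_%_; m%n<n)
open import Data.Fin using (Fin; toℕ; fromℕ<)
open import Data.Product using (_×_; _,_; proj₁; proj₂; ∃)
open import Data.Sum using (_⊎_; inj₁; inj₂)
open import Data.List using (List; length)
open import Data.List.Membership.Propositional using (_∈_)
open import Data.List.Relation.Unary.Unique.Propositional using (Unique)
open import Relation.Binary.PropositionalEquality using (_≡_)

record Graph : Set₁ where
  field
    V    : Set
    E    : Set
    ends : E → V × V

module _ (G : Graph) where
  open Graph G

  _IncidentTo_ : V → E → Set
  a IncidentTo e = (proj₁ (ends e) ≡ a) ⊎ (proj₂ (ends e) ≡ a)

  AdjV : V → V → Set
  AdjV a b = ∃ λ e → (proj₁ (ends e) ≡ a × proj₂ (ends e) ≡ b)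
                   ⊎ (proj₁ (ends e) ≡ b × proj₂ (ends e) ≡ a)

  AdjE : E → E → Set
  AdjE e f = ∃ λ a → (a IncidentTo e) × (a IncidentTo f)

  Elem : Set
  Elem = V ⊎ E

  Related : Elem → Elem → Set
  Related (inj₁ a) (inj₁ b) = AdjV a b
  Related (inj₁ a) (inj₂ e) = a IncidentTo e
  Related (inj₂ e) (inj₁ a) = a IncidentTo e
  Related (inj₂ e) (inj₂ f) = AdjE e f

  IsMixedDominating : List Elem → Set
  IsMixedDominating S = ∀ x → (x ∈ S) ⊎ (∃ λ y → y ∈ S × Related y x)

  IsMixedDominationNumber : ℕ → Set
  IsMixedDominationNumber t =
    (∃ λ S → Unique S × IsMixedDominating S × length S ≡ t)
    × (∀ S → Unique S → IsMixedDominating S → t ≤ length S)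

shift : {n : ℕ} → Fin n → ℕ → Fin n
shift {zero} () k
shift {suc n} i k = fromℕ< (m%n<n (toℕ i + k) (suc n))

data PVertex (n : ℕ) : Set where
  v : Fin n → PVertex n
  u : Fin n → PVertex n

data PEdge (n : ℕ) : Set where
  outer : Fin n → PEdge n
  spoke : Fin n → PEdge n
  inner : Fin n → PEdge n

Petersen : (n k : ℕ) → Graph
Petersen n k = record
  { V = PVertex n
  ; E = PEdge n
  ; ends = λ { (outer i) → v i , v (shift i 1)
             ; (spoke i) → v i , u i
             ; (inner i) → u i , u (shift i k) } }

formula : ℕ → ℕ → ℕ
formula m 0 = 6 * m
formula m 1 = 6 * m + 2
formula m 2 = 6 * m + 2
formula m 3 = 6 * m + 3
formula m 4 = 6 * m + 4
formula m 5 = 6 * m + 4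
formula m 6 = 6 * m + 5
formula m _ = 6 * m + 6

-- Record a set S of vertices and edges of P(n,1) column by column: column j says which of
-- v_j, u_j, the spoke v_j u_j, the outer edge v_j v_(j+1) and the inner edge u_j u_(j+1) lie
-- in S. Since P(n,1) is a prism, S is mixed dominating exactly when every three cyclically
-- consecutive columns pass a fixed local test, so γ_md is the minimum weight of a closed walk
-- of length n in a finite automaton. A computer-found abstraction κ of pairs of columns into 20
-- states with a min-plus transfer matrix Mt bounds every such walk below by a diagonal entry of
-- Mt ^ n; from the 5th power on these powers grow by exactly 6 every 8 steps, which gives the
-- lower bound. The matching sets repeat a block of 8 columns of weight 6 and close the cycle
-- with one of eight tails chosen by n mod 8.

module Submission where

open import Defs
open import Data.Bool using (Bool; true; false; T; if_then_else_; _∧_; _∨_)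
open import Data.Bool.ListAction using (all; any)
open import Data.Bool.Properties using (T?; T-∧)
open import Data.Fin using (Fin; toℕ; #_) renaming (zero to fzero; suc to fsuc; _≟_ to _≟ᶠ_)
open import Data.Fin.Properties using (all?; toℕ-fromℕ<; toℕ-injective; toℕ<n)
open import Data.List using (List; []; _∷_; _++_; map; length; take; lookup; applyUpTo; tabulate; allFin; filterᵇ; cartesianProductWith; _∷ʳ_)
open import Data.List.Membership.DecPropositional using () renaming (_∈?_ to member?)
open import Data.List.Membership.Propositional using (_∈_; lose)
open import Data.List.Membership.Propositional.Properties using (∈-lookup; ∈-cartesianProductWith⁺; ∈-allFin; ∈-filter⁺; ∈-filter⁻)
open import Data.List.Membership.Propositional.Properties.WithK using (unique∧set⇒bag)
open import Data.List.Properties using (applyUpTo-∷ʳ; map-applyUpTo; ++-assoc; length-++; length-take; map-++)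
open import Data.List.Relation.Binary.BagAndSetEquality using (∼bag⇒↭)
open import Data.List.Relation.Binary.Permutation.Propositional.Properties using (↭-length)
open import Data.List.Relation.Unary.All as All using (All; []; _∷_)
open import Data.List.Relation.Unary.All.Properties using (all⁻; all⁺)
open import Data.List.Relation.Unary.AllPairs using ([]; _∷_)
open import Data.List.Relation.Unary.Any as Any using (Any; here; there)
open import Data.List.Relation.Unary.Any.Properties using (any⁺; any⁻)
open import Data.List.Relation.Unary.Unique.Propositional using (Unique)
open import Data.List.Relation.Unary.Unique.Propositional.Properties using (cartesianProductWith⁺; filter⁺; allFin⁺)
open import Data.Nat using (ℕ; zero; suc; _+_; _*_; _∸_; _⊓_; _≤_; _<_; _/_; _%_; z≤n; s≤s; _<?_)
open import Data.Nat.DivMod using (m%n<n; m<n⇒m%n≡m; [m+n]%n≡m%n; %-distribˡ-+; m%n%n≡m%n; m/n≡1+[m∸n]/n; m≡m%n+[m/n]*n; m≥n⇒m/n>0)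
open import Data.Nat.ListAction using (sum)
open import Data.Nat.ListAction.Properties using (sum-++)
open import Data.Nat.Properties
open import Data.Nat.Tactic.RingSolver using (solve-∀)
open import Data.Product using (Σ; ∃; _×_; _,_; proj₁; proj₂)
open import Data.Sum using (_⊎_; inj₁; inj₂)
open import Data.Sum.Properties using (≡-dec)
open import Data.Vec as Vec using (Vec; []; _∷_)
open import Data.Vec.Properties using (lookup∘tabulate)
open import Function using (_∘_; _⇔_; mk⇔; Equivalence)
open import Relation.Binary.Definitions using (Decidable; DecidableEquality)
open import Relation.Binary.PropositionalEquality
open import Relation.Nullary.Decidable using (Dec; yes; no; map′; from-yes; isYes; fromWitness; toWitness; _×-dec_; _→-dec_)

-- Min-plus matrices

data ℕ∞ : Set where
  fin : ℕ → ℕ∞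
  ∞   : ℕ∞

infixl 6 _+∞_ _⊓∞_
infix 4 _≤∞_ _≟∞_ _≤∞?_

_+∞_ : ℕ∞ → ℕ∞ → ℕ∞
fin a +∞ fin b = fin (a + b)
_     +∞ _     = ∞

_⊓∞_ : ℕ∞ → ℕ∞ → ℕ∞
fin a ⊓∞ fin b = fin (a ⊓ b)
fin a ⊓∞ ∞     = fin a
∞     ⊓∞ y     = y

data _≤∞_ : ℕ∞ → ℕ∞ → Set where
  fin≤fin : ∀ {a b} → a ≤ b → fin a ≤∞ fin b
  _≤∞∞    : ∀ x → x ≤∞ ∞

fin≤fin⁻¹ : ∀ {a b} → fin a ≤∞ fin b → a ≤ b
fin≤fin⁻¹ (fin≤fin a≤b) = a≤b

fin-injective : ∀ {a b} → fin a ≡ fin b → a ≡ b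
fin-injective refl = refl

_≟∞_ : DecidableEquality ℕ∞
fin a ≟∞ fin b = map′ (cong fin) fin-injective (a ≟ b)
fin a ≟∞ ∞     = no λ ()
∞     ≟∞ fin b = no λ ()
∞     ≟∞ ∞     = yes refl

_≤∞?_ : Decidable _≤∞_
fin a ≤∞? fin b = map′ fin≤fin fin≤fin⁻¹ (a ≤? b)
x     ≤∞? ∞     = yes (x ≤∞∞)
∞     ≤∞? fin b = no λ ()

≤∞-trans : ∀ {x y z} → x ≤∞ y → y ≤∞ z → x ≤∞ z
≤∞-trans (fin≤fin p) (fin≤fin q) = fin≤fin (≤-trans p q)
≤∞-trans p           (_ ≤∞∞)     = _ ≤∞∞

+∞-mono-fin : ∀ {x y a b} → x ≤∞ fin a → y ≤∞ fin b → x +∞ y ≤∞ fin (a + b)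
+∞-mono-fin (fin≤fin p) (fin≤fin q) = fin≤fin (+-mono-≤ p q)

+∞-monoʳ : ∀ c {x y} → x ≤∞ y → fin c +∞ x ≤∞ fin c +∞ y
+∞-monoʳ c (fin≤fin p) = fin≤fin (+-monoʳ-≤ c p)
+∞-monoʳ c (_ ≤∞∞)     = _ ≤∞∞

⊓∞-≤ˡ : ∀ x y → x ⊓∞ y ≤∞ x
⊓∞-≤ˡ (fin a) (fin b) = fin≤fin (m⊓n≤m a b)
⊓∞-≤ˡ (fin a) ∞       = fin≤fin ≤-refl
⊓∞-≤ˡ ∞       y       = y ≤∞∞

⊓∞-≤ʳ : ∀ x y → x ⊓∞ y ≤∞ y
⊓∞-≤ʳ (fin a) (fin b) = fin≤fin (m⊓n≤n a b)
⊓∞-≤ʳ (fin a) ∞       = fin a ≤∞∞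
⊓∞-≤ʳ ∞       (fin b) = fin≤fin ≤-refl
⊓∞-≤ʳ ∞       ∞       = ∞ ≤∞∞

+∞-distribˡ-⊓∞ : ∀ c x y → fin c +∞ (x ⊓∞ y) ≡ (fin c +∞ x) ⊓∞ (fin c +∞ y)
+∞-distribˡ-⊓∞ c (fin a) (fin b) = cong fin (+-distribˡ-⊓ c a b)
+∞-distribˡ-⊓∞ c (fin a) ∞       = refl
+∞-distribˡ-⊓∞ c ∞       y       = refl

+∞-assoc-fin : ∀ c x y → (fin c +∞ x) +∞ y ≡ fin c +∞ (x +∞ y)
+∞-assoc-fin c (fin a) (fin b) = cong fin (+-assoc c a b)
+∞-assoc-fin c (fin a) ∞       = refl
+∞-assoc-fin c ∞       y       = refl

⨅ : ∀ {n} → (Fin n → ℕ∞) → ℕ∞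
⨅ {zero}  f = ∞
⨅ {suc n} f = f fzero ⊓∞ ⨅ (f ∘ fsuc)

⨅-≤ : ∀ {n} (f : Fin n → ℕ∞) i → ⨅ f ≤∞ f i
⨅-≤ f fzero    = ⊓∞-≤ˡ (f fzero) _
⨅-≤ f (fsuc i) = ≤∞-trans (⊓∞-≤ʳ (f fzero) _) (⨅-≤ (f ∘ fsuc) i)

⨅-cong : ∀ {n} {f g : Fin n → ℕ∞} → (∀ i → f i ≡ g i) → ⨅ f ≡ ⨅ g
⨅-cong {zero}  eq = refl
⨅-cong {suc n} eq = cong₂ _⊓∞_ (eq fzero) (⨅-cong (eq ∘ fsuc))

⨅-+∞ : ∀ {n} c (f : Fin n → ℕ∞) → ⨅ (λ i → fin c +∞ f i) ≡ fin c +∞ ⨅ f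
⨅-+∞ {zero}  c f = refl
⨅-+∞ {suc n} c f = trans (cong (fin c +∞ f fzero ⊓∞_) (⨅-+∞ c (f ∘ fsuc)))
                         (sym (+∞-distribˡ-⊓∞ c (f fzero) _))

Matrix : ℕ → Set
Matrix n = Vec (Vec ℕ∞ n) n

_⟨_,_⟩ : ∀ {n} → Matrix n → Fin n → Fin n → ℕ∞
M ⟨ p , q ⟩ = Vec.lookup (Vec.lookup M p) q

infixl 7 _⊗_
_⊗_ : ∀ {n} → Matrix n → Matrix n → Matrix n
A ⊗ B = Vec.tabulate λ p → Vec.tabulate λ q → ⨅ λ r → A ⟨ p , r ⟩ +∞ B ⟨ r , q ⟩

⊗-entry : ∀ {n} (A B : Matrix n) p q → (A ⊗ B) ⟨ p , q ⟩ ≡ ⨅ (λ r → A ⟨ p , r ⟩ +∞ B ⟨ r , q ⟩)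
⊗-entry A B p q
  rewrite lookup∘tabulate (λ p → Vec.tabulate λ q → ⨅ λ r → A ⟨ p , r ⟩ +∞ B ⟨ r , q ⟩) p =
  lookup∘tabulate _ q

⊗-≤ : ∀ {n} (A B : Matrix n) p r q → (A ⊗ B) ⟨ p , q ⟩ ≤∞ A ⟨ p , r ⟩ +∞ B ⟨ r , q ⟩
⊗-≤ A B p r q rewrite ⊗-entry A B p q = ⨅-≤ (λ r → A ⟨ p , r ⟩ +∞ B ⟨ r , q ⟩) r

δ : ∀ {n} → Fin n → Fin n → ℕ∞
δ fzero    fzero    = fin 0
δ (fsuc p) (fsuc q) = δ p q
δ _        _        = ∞

δ-refl : ∀ {n} (p : Fin n) → δ p p ≡ fin 0
δ-refl fzero    = refl
δ-refl (fsuc p) = δ-refl p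

𝟙 : ∀ {n} → Matrix n
𝟙 = Vec.tabulate λ p → Vec.tabulate λ q → δ p q

𝟙-diagonal : ∀ {n} (p : Fin n) → 𝟙 ⟨ p , p ⟩ ≡ fin 0
𝟙-diagonal p rewrite lookup∘tabulate (λ p → Vec.tabulate λ q → δ p q) p
                   | lookup∘tabulate (δ p) p = δ-refl p

infixr 8 _^_
_^_ : ∀ {n} → Matrix n → ℕ → Matrix n
M ^ zero  = 𝟙
M ^ suc k = M ^ k ⊗ M

sum-applyUpTo-suc : ∀ (w : ℕ → ℕ) L → sum (applyUpTo w (suc L)) ≡ sum (applyUpTo w L) + w L
sum-applyUpTo-suc w L = begin
  sum (applyUpTo w (suc L))         ≡⟨ cong sum (applyUpTo-∷ʳ w L) ⟨
  sum (applyUpTo w L ∷ʳ w L)        ≡⟨ sum-++ (applyUpTo w L) _ ⟩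
  sum (applyUpTo w L) + (w L + 0)   ≡⟨ cong (sum (applyUpTo w L) +_) (+-identityʳ (w L)) ⟩
  sum (applyUpTo w L) + w L         ∎
  where open ≡-Reasoning

^-≤-walk : ∀ {n} (M : Matrix n) (s : ℕ → Fin n) (w : ℕ → ℕ) →
           (∀ k → M ⟨ s k , s (suc k) ⟩ ≤∞ fin (w k)) →
           ∀ L → (M ^ L) ⟨ s 0 , s L ⟩ ≤∞ fin (sum (applyUpTo w L))
^-≤-walk M s w step zero    = subst (_≤∞ fin 0) (sym (𝟙-diagonal (s 0))) (fin≤fin z≤n)
^-≤-walk M s w step (suc L) =
  subst (λ t → (M ^ suc L) ⟨ s 0 , s (suc L) ⟩ ≤∞ fin t) (sym (sum-applyUpTo-suc w L))
        (≤∞-trans (⊗-≤ (M ^ L) M (s 0) (s L) (s (suc L)))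
                  (+∞-mono-fin (^-≤-walk M s w step L) (step L)))

^-periodic : ∀ {n} (M : Matrix n) a d c →
             (∀ p q → (M ^ (a + d)) ⟨ p , q ⟩ ≡ fin c +∞ (M ^ a) ⟨ p , q ⟩) →
             ∀ k p q → (M ^ (k + (a + d))) ⟨ p , q ⟩ ≡ fin c +∞ (M ^ (k + a)) ⟨ p , q ⟩
^-periodic M a d c base zero        = base
^-periodic M a d c base (suc k) p q = begin
  (M ^ (k + (a + d)) ⊗ M) ⟨ p , q ⟩                            ≡⟨ ⊗-entry (M ^ (k + (a + d))) M p q ⟩
  ⨅ (λ r → (M ^ (k + (a + d))) ⟨ p , r ⟩ +∞ M ⟨ r , q ⟩)       ≡⟨ ⨅-cong shifted ⟩
  ⨅ (λ r → fin c +∞ ((M ^ (k + a)) ⟨ p , r ⟩ +∞ M ⟨ r , q ⟩))  ≡⟨ ⨅-+∞ c (λ r → (M ^ (k + a)) ⟨ p , r ⟩ +∞ M ⟨ r , q ⟩) ⟩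
  fin c +∞ ⨅ (λ r → (M ^ (k + a)) ⟨ p , r ⟩ +∞ M ⟨ r , q ⟩)    ≡⟨ cong (fin c +∞_) (⊗-entry (M ^ (k + a)) M p q) ⟨
  fin c +∞ (M ^ (k + a) ⊗ M) ⟨ p , q ⟩                         ∎
  where
  open ≡-Reasoning
  shifted : ∀ r → (M ^ (k + (a + d))) ⟨ p , r ⟩ +∞ M ⟨ r , q ⟩
                ≡ fin c +∞ ((M ^ (k + a)) ⟨ p , r ⟩ +∞ M ⟨ r , q ⟩)
  shifted r = trans (cong (_+∞ M ⟨ r , q ⟩) (^-periodic M a d c base k p r)) (+∞-assoc-fin c _ _)

-- The matrices are arguments so that the type checker evaluates each power only once.
entrywise? : ∀ {n} {R : ℕ∞ → ℕ∞ → Set} → Decidable R → (A B : Matrix n) →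
             Dec (∀ p q → R (A ⟨ p , q ⟩) (B ⟨ p , q ⟩))
entrywise? R? A B = all? λ p → all? λ q → R? (A ⟨ p , q ⟩) (B ⟨ p , q ⟩)

diagonal? : ∀ {n} {P : ℕ∞ → Set} → (∀ x → Dec (P x)) → (A : Matrix n) → Dec (∀ p → P (A ⟨ p , p ⟩))
diagonal? P? A = all? λ p → P? (A ⟨ p , p ⟩)

-- Columns and the local domination test

data Kind : Set where
  V U Spoke Outer Inner : Kind

kinds : List Kind
kinds = V ∷ U ∷ Spoke ∷ Outer ∷ Inner ∷ []

record Column : Set where
  constructor column
  field hasV hasU hasSpoke hasOuter hasInner : Bool

bit : Column → Kind → Bool
bit c V     = Column.hasV c
bit c U     = Column.hasU c
bit c Spoke = Column.hasSpoke c
bit c Outer = Column.hasOuter c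
bit c Inner = Column.hasInner c

indicator : Bool → ℕ
indicator b = if b then 1 else 0

weight : Column → ℕ
weight c = sum (map (indicator ∘ bit c) kinds)

data Offset : Set where
  left mid right : Offset

pick : Column → Column → Column → Offset → Column
pick a b c left  = a
pick a b c mid   = b
pick a b c right = c

-- The closed neighbourhood in P(n,1) of the element of kind k in column j, as pairs
-- (column offset, kind), with the element itself first.
neighbourhood : Kind → List (Offset × Kind)
neighbourhood V     = (mid , V) ∷ (left , V) ∷ (right , V) ∷ (mid , U) ∷ (left , Outer) ∷ (mid , Outer) ∷ (mid , Spoke) ∷ []
neighbourhood U     = (mid , U) ∷ (left , U) ∷ (right , U) ∷ (mid , V) ∷ (left , Inner) ∷ (mid , Inner) ∷ (mid , Spoke) ∷ []
neighbourhood Spoke = (mid , Spoke) ∷ (mid , V) ∷ (mid , U) ∷ (left , Outer) ∷ (mid , Outer) ∷ (left , Inner) ∷ (mid , Inner) ∷ []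
neighbourhood Outer = (mid , Outer) ∷ (mid , V) ∷ (right , V) ∷ (left , Outer) ∷ (right , Outer) ∷ (mid , Spoke) ∷ (right , Spoke) ∷ []
neighbourhood Inner = (mid , Inner) ∷ (mid , U) ∷ (right , U) ∷ (left , Inner) ∷ (right , Inner) ∷ (mid , Spoke) ∷ (right , Spoke) ∷ []

kind∈kinds : ∀ k → k ∈ kinds
kind∈kinds V     = here refl
kind∈kinds U     = there (here refl)
kind∈kinds Spoke = there (there (here refl))
kind∈kinds Outer = there (there (there (here refl)))
kind∈kinds Inner = there (there (there (there (here refl))))

kinds-unique : Unique kinds
kinds-unique = ((λ ()) ∷ (λ ()) ∷ (λ ()) ∷ (λ ()) ∷ []) ∷ ((λ ()) ∷ (λ ()) ∷ (λ ()) ∷ []) ∷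
               ((λ ()) ∷ (λ ()) ∷ []) ∷ ((λ ()) ∷ []) ∷ [] ∷ []

mid∈neighbourhood : ∀ k → (mid , k) ∈ neighbourhood k
mid∈neighbourhood V     = here refl
mid∈neighbourhood U     = here refl
mid∈neighbourhood Spoke = here refl
mid∈neighbourhood Outer = here refl
mid∈neighbourhood Inner = here refl

marked : Column → Column → Column → Offset × Kind → Bool
marked a b c (o , k) = bit (pick a b c o) k

dominatedAt : Column → Column → Column → Bool
dominatedAt a b c = all (λ k → any (marked a b c) (neighbourhood k)) kinds

∀-Bool? : {P : Bool → Set} → (∀ b → Dec (P b)) → Dec (∀ b → P b)
∀-Bool? P? = map′ (λ { (t , f) true → t ; (t , f) false → f }) (λ h → h true , h false) (P? true ×-dec P? false)

∀-Column? : {P : Column → Set} → (∀ c → Dec (P c)) → Dec (∀ c → P c)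
∀-Column? P? =
  map′ (λ h c → h (Column.hasV c) (Column.hasU c) (Column.hasSpoke c) (Column.hasOuter c) (Column.hasInner c))
       (λ h a b c d e → h (column a b c d e))
       (∀-Bool? λ a → ∀-Bool? λ b → ∀-Bool? λ c → ∀-Bool? λ d → ∀-Bool? λ e → P? (column a b c d e))

-- The transfer-matrix certificate

-- Found by computer search: κ sorts a pair of consecutive columns into one of 20 states, and
-- Mt is the min-plus transfer matrix between these states (κ-transition).
κ : Column → Column → Fin 20
κ (column av au _ ao ai) (column bv bu bs bo bi) =
  if bo then (if bi then # 15 else if bu then # 9 else if bs ∨ ai then # 10 else if bv ∨ au then # 8 else # 7)
  else if bv then (if bi then # 12 else if bu then # 3 else if bs ∨ ai then # 5 else # 1)
  else if bi then (if bs ∨ ao then # 14 else if bu ∨ av then # 13 else # 11)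
  else if bu then (if bs ∨ ao then # 6 else # 2)
  else if bs then # 4
  else if ao then (if ai then # 4 else if au then # 17 else # 16)
  else if ai then (if av then # 19 else # 18)
  else # 0

Mt : Matrix 20
Mt =
  ( ∞ ∷ ∞ ∷ ∞ ∷ ∞ ∷ ∞ ∷ ∞ ∷ ∞ ∷ ∞ ∷ ∞ ∷ ∞ ∷ ∞ ∷ ∞ ∷ ∞ ∷ ∞ ∷ ∞ ∷ ∞ ∷ ∞ ∷ ∞ ∷ ∞ ∷ ∞ ∷ [])
  ∷ (∞ ∷ ∞ ∷ fin 1 ∷ fin 2 ∷ fin 1 ∷ fin 2 ∷ fin 2 ∷ ∞ ∷ ∞ ∷ fin 2 ∷ fin 2 ∷ ∞ ∷ fin 2 ∷ fin 1 ∷ fin 2 ∷ fin 2 ∷ ∞ ∷ ∞ ∷ ∞ ∷ ∞ ∷ [])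
  ∷ (∞ ∷ fin 1 ∷ ∞ ∷ fin 2 ∷ fin 1 ∷ fin 2 ∷ fin 2 ∷ ∞ ∷ fin 1 ∷ fin 2 ∷ fin 2 ∷ ∞ ∷ fin 2 ∷ ∞ ∷ fin 2 ∷ fin 2 ∷ ∞ ∷ ∞ ∷ ∞ ∷ ∞ ∷ [])
  ∷ (fin 0 ∷ fin 1 ∷ fin 1 ∷ fin 2 ∷ fin 1 ∷ fin 2 ∷ fin 2 ∷ ∞ ∷ fin 1 ∷ fin 2 ∷ fin 2 ∷ ∞ ∷ fin 2 ∷ fin 1 ∷ fin 2 ∷ fin 2 ∷ ∞ ∷ ∞ ∷ ∞ ∷ ∞ ∷ [])
  ∷ (fin 0 ∷ fin 1 ∷ fin 1 ∷ fin 2 ∷ fin 1 ∷ fin 2 ∷ fin 2 ∷ fin 1 ∷ fin 2 ∷ fin 2 ∷ fin 2 ∷ fin 1 ∷ fin 2 ∷ fin 2 ∷ fin 2 ∷ fin 2 ∷ ∞ ∷ ∞ ∷ ∞ ∷ ∞ ∷ [])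
  ∷ (fin 0 ∷ fin 1 ∷ fin 1 ∷ fin 2 ∷ fin 1 ∷ fin 2 ∷ fin 2 ∷ fin 1 ∷ fin 2 ∷ fin 2 ∷ fin 2 ∷ ∞ ∷ fin 2 ∷ fin 1 ∷ fin 2 ∷ fin 2 ∷ ∞ ∷ ∞ ∷ ∞ ∷ ∞ ∷ [])
  ∷ (fin 0 ∷ fin 1 ∷ fin 1 ∷ fin 2 ∷ fin 1 ∷ fin 2 ∷ fin 2 ∷ ∞ ∷ fin 1 ∷ fin 2 ∷ fin 2 ∷ fin 1 ∷ fin 2 ∷ fin 2 ∷ fin 2 ∷ fin 2 ∷ ∞ ∷ ∞ ∷ ∞ ∷ ∞ ∷ [])
  ∷ (∞ ∷ ∞ ∷ ∞ ∷ fin 2 ∷ ∞ ∷ ∞ ∷ fin 1 ∷ ∞ ∷ ∞ ∷ fin 2 ∷ ∞ ∷ ∞ ∷ fin 3 ∷ ∞ ∷ fin 2 ∷ fin 3 ∷ ∞ ∷ ∞ ∷ ∞ ∷ ∞ ∷ [])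
  ∷ (∞ ∷ ∞ ∷ ∞ ∷ fin 2 ∷ fin 1 ∷ fin 2 ∷ fin 1 ∷ ∞ ∷ ∞ ∷ fin 2 ∷ fin 2 ∷ ∞ ∷ fin 2 ∷ ∞ ∷ fin 1 ∷ fin 2 ∷ ∞ ∷ ∞ ∷ ∞ ∷ ∞ ∷ [])
  ∷ (∞ ∷ fin 1 ∷ ∞ ∷ fin 2 ∷ fin 1 ∷ fin 2 ∷ fin 1 ∷ ∞ ∷ fin 1 ∷ fin 2 ∷ fin 2 ∷ ∞ ∷ fin 2 ∷ ∞ ∷ fin 1 ∷ fin 2 ∷ ∞ ∷ fin 0 ∷ ∞ ∷ ∞ ∷ [])
  ∷ (∞ ∷ fin 1 ∷ ∞ ∷ fin 2 ∷ fin 1 ∷ fin 2 ∷ fin 1 ∷ fin 1 ∷ fin 2 ∷ fin 2 ∷ fin 2 ∷ ∞ ∷ fin 2 ∷ ∞ ∷ fin 1 ∷ fin 2 ∷ fin 0 ∷ ∞ ∷ ∞ ∷ ∞ ∷ [])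
  ∷ (∞ ∷ ∞ ∷ ∞ ∷ fin 2 ∷ ∞ ∷ fin 1 ∷ ∞ ∷ ∞ ∷ ∞ ∷ fin 3 ∷ fin 2 ∷ ∞ ∷ fin 2 ∷ ∞ ∷ ∞ ∷ fin 3 ∷ ∞ ∷ ∞ ∷ ∞ ∷ ∞ ∷ [])
  ∷ (∞ ∷ ∞ ∷ fin 1 ∷ fin 2 ∷ fin 1 ∷ fin 1 ∷ fin 2 ∷ ∞ ∷ ∞ ∷ fin 2 ∷ fin 1 ∷ ∞ ∷ fin 2 ∷ fin 1 ∷ fin 2 ∷ fin 2 ∷ ∞ ∷ ∞ ∷ ∞ ∷ fin 0 ∷ [])
  ∷ (∞ ∷ ∞ ∷ ∞ ∷ fin 2 ∷ fin 1 ∷ fin 1 ∷ fin 2 ∷ ∞ ∷ ∞ ∷ fin 2 ∷ fin 1 ∷ ∞ ∷ fin 2 ∷ ∞ ∷ fin 2 ∷ fin 2 ∷ ∞ ∷ ∞ ∷ ∞ ∷ ∞ ∷ [])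
  ∷ (∞ ∷ ∞ ∷ fin 1 ∷ fin 2 ∷ fin 1 ∷ fin 1 ∷ fin 2 ∷ ∞ ∷ ∞ ∷ fin 2 ∷ fin 1 ∷ fin 1 ∷ fin 2 ∷ fin 2 ∷ fin 2 ∷ fin 2 ∷ ∞ ∷ ∞ ∷ fin 0 ∷ ∞ ∷ [])
  ∷ (∞ ∷ ∞ ∷ ∞ ∷ fin 2 ∷ fin 0 ∷ fin 1 ∷ fin 1 ∷ ∞ ∷ ∞ ∷ fin 2 ∷ fin 1 ∷ ∞ ∷ fin 2 ∷ ∞ ∷ fin 1 ∷ fin 2 ∷ ∞ ∷ ∞ ∷ ∞ ∷ ∞ ∷ [])
  ∷ (∞ ∷ ∞ ∷ fin 1 ∷ fin 2 ∷ ∞ ∷ ∞ ∷ fin 2 ∷ ∞ ∷ ∞ ∷ fin 2 ∷ ∞ ∷ ∞ ∷ fin 3 ∷ fin 2 ∷ fin 3 ∷ fin 3 ∷ ∞ ∷ ∞ ∷ ∞ ∷ ∞ ∷ [])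
  ∷ (∞ ∷ ∞ ∷ fin 1 ∷ fin 2 ∷ fin 1 ∷ fin 2 ∷ fin 2 ∷ ∞ ∷ ∞ ∷ fin 2 ∷ fin 2 ∷ fin 1 ∷ fin 2 ∷ fin 2 ∷ fin 2 ∷ fin 2 ∷ ∞ ∷ ∞ ∷ ∞ ∷ ∞ ∷ [])
  ∷ (∞ ∷ fin 1 ∷ ∞ ∷ fin 2 ∷ ∞ ∷ fin 2 ∷ ∞ ∷ ∞ ∷ fin 2 ∷ fin 3 ∷ fin 3 ∷ ∞ ∷ fin 2 ∷ ∞ ∷ ∞ ∷ fin 3 ∷ ∞ ∷ ∞ ∷ ∞ ∷ ∞ ∷ [])
  ∷ (∞ ∷ fin 1 ∷ ∞ ∷ fin 2 ∷ fin 1 ∷ fin 2 ∷ fin 2 ∷ fin 1 ∷ fin 2 ∷ fin 2 ∷ fin 2 ∷ ∞ ∷ fin 2 ∷ ∞ ∷ fin 2 ∷ fin 2 ∷ ∞ ∷ ∞ ∷ ∞ ∷ ∞ ∷ [])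
  ∷ []

κ-transition : ∀ a b c → T (dominatedAt a b c) → Mt ⟨ κ a b , κ b c ⟩ ≤∞ fin (weight c)
κ-transition = from-yes (∀-Column? λ a → ∀-Column? λ b → ∀-Column? λ c →
  T? (dominatedAt a b c) →-dec Mt ⟨ κ a b , κ b c ⟩ ≤∞? fin (weight c))

Mt-periodic : ∀ p q → (Mt ^ (5 + 8)) ⟨ p , q ⟩ ≡ fin 6 +∞ (Mt ^ 5) ⟨ p , q ⟩
Mt-periodic = from-yes (entrywise? (λ x y → x ≟∞ fin 6 +∞ y) (Mt ^ (5 + 8)) (Mt ^ 5))

γ : ℕ → ℕ
γ n = formula (n / 8) (n % 8)

formula-suc : ∀ q r → formula (suc q) r ≡ 6 + formula q r
formula-suc q 0 = *-suc 6 q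
formula-suc q 1 = cong (_+ 2) (*-suc 6 q)
formula-suc q 2 = cong (_+ 2) (*-suc 6 q)
formula-suc q 3 = cong (_+ 3) (*-suc 6 q)
formula-suc q 4 = cong (_+ 4) (*-suc 6 q)
formula-suc q 5 = cong (_+ 4) (*-suc 6 q)
formula-suc q 6 = cong (_+ 5) (*-suc 6 q)
formula-suc q (suc (suc (suc (suc (suc (suc (suc r))))))) = cong (_+ 6) (*-suc 6 q)

γ-+8 : ∀ n → γ (8 + n) ≡ 6 + γ n
γ-+8 n = trans (cong₂ formula (m/n≡1+[m∸n]/n (m≤m+n 8 n))
                              (trans (cong (_% 8) (+-comm 8 n)) ([m+n]%n≡m%n n 8)))
               (formula-suc (n / 8) (n % 8))

DiagonalBound : ℕ → Set
DiagonalBound N = ∀ p → fin (γ N) ≤∞ (Mt ^ N) ⟨ p , p ⟩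

-- A stands for Mt ^ a and is passed on, so that each power is evaluated only once.
diagonals? : ∀ a (A : Matrix 20) → A ≡ Mt ^ a → ∀ count → Dec (∀ (i : Fin count) → DiagonalBound (toℕ i + a))
diagonals? a A A≡ zero        = yes λ ()
diagonals? a A A≡ (suc count) =
  map′ (λ { (h , hs) fzero → h ; (h , hs) (fsuc i) → subst DiagonalBound (+-suc (toℕ i) a) (hs i) })
       (λ h → h fzero , λ i → subst DiagonalBound (sym (+-suc (toℕ i) a)) (h (fsuc i)))
       (subst (λ B → Dec (∀ p → fin (γ a) ≤∞ B ⟨ p , p ⟩)) A≡ (diagonal? (fin (γ a) ≤∞?_) A)
        ×-dec diagonals? (suc a) (A ⊗ Mt) (cong (_⊗ Mt) A≡) count)

first-diagonals : ∀ (i : Fin 8) → DiagonalBound (toℕ i + 5)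
first-diagonals = from-yes (diagonals? 5 (Mt ^ 5) refl 8)

Mt-diagonal : ∀ k → DiagonalBound (5 + k)
Mt-diagonal 0 = first-diagonals (# 0)
Mt-diagonal 1 = first-diagonals (# 1)
Mt-diagonal 2 = first-diagonals (# 2)
Mt-diagonal 3 = first-diagonals (# 3)
Mt-diagonal 4 = first-diagonals (# 4)
Mt-diagonal 5 = first-diagonals (# 5)
Mt-diagonal 6 = first-diagonals (# 6)
Mt-diagonal 7 = first-diagonals (# 7)
Mt-diagonal (suc (suc (suc (suc (suc (suc (suc (suc k)))))))) p =
  subst₂ _≤∞_ (cong fin (sym (γ-+8 (5 + k)))) (sym periodic) (+∞-monoʳ 6 (Mt-diagonal k p))
  where
  open ≡-Reasoning
  periodic : (Mt ^ (13 + k)) ⟨ p , p ⟩ ≡ fin 6 +∞ (Mt ^ (5 + k)) ⟨ p , p ⟩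
  periodic = begin
    (Mt ^ (13 + k)) ⟨ p , p ⟩           ≡⟨ cong (λ m → (Mt ^ m) ⟨ p , p ⟩) (+-comm 13 k) ⟩
    (Mt ^ (k + 13)) ⟨ p , p ⟩           ≡⟨ ^-periodic Mt 5 8 6 Mt-periodic k p p ⟩
    fin 6 +∞ (Mt ^ (k + 5)) ⟨ p , p ⟩   ≡⟨ cong (λ m → fin 6 +∞ (Mt ^ m) ⟨ p , p ⟩) (+-comm k 5) ⟩
    fin 6 +∞ (Mt ^ (5 + k)) ⟨ p , p ⟩   ∎

-- Cyclic arrangements of columns

map-tabulate≡applyUpTo : ∀ {A B : Set} {m} (h : A → B) (g : Fin m → A) (g′ : ℕ → B) →
                         (∀ i → h (g i) ≡ g′ (toℕ i)) → map h (tabulate g) ≡ applyUpTo g′ m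
map-tabulate≡applyUpTo {m = zero}  h g g′ eq = refl
map-tabulate≡applyUpTo {m = suc m} h g g′ eq =
  cong₂ _∷_ (eq fzero) (map-tabulate≡applyUpTo h (g ∘ fsuc) (g′ ∘ suc) (eq ∘ fsuc))

sum-applyUpTo-rotate : ∀ (h : ℕ → ℕ) L → h L ≡ h 0 → sum (applyUpTo (h ∘ suc) L) ≡ sum (applyUpTo h L)
sum-applyUpTo-rotate h L hL≡h0 = +-cancelˡ-≡ (h 0) _ _ (begin
  sum (applyUpTo h (suc L))       ≡⟨ sum-applyUpTo-suc h L ⟩
  sum (applyUpTo h L) + h L       ≡⟨ cong (sum (applyUpTo h L) +_) hL≡h0 ⟩
  sum (applyUpTo h L) + h 0       ≡⟨ +-comm _ (h 0) ⟩
  h 0 + sum (applyUpTo h L)       ∎)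
  where open ≡-Reasoning

module _ {n : ℕ} where

  private
    N : ℕ
    N = suc n

  toℕ-shift : ∀ (i : Fin N) k → toℕ (shift i k) ≡ (toℕ i + k) % N
  toℕ-shift i k = toℕ-fromℕ< _

  [m%n+k]%n≡[m+k]%n : ∀ m k → (m % N + k) % N ≡ (m + k) % N
  [m%n+k]%n≡[m+k]%n m k = begin
    (m % N + k) % N             ≡⟨ %-distribˡ-+ (m % N) k N ⟩
    (m % N % N + k % N) % N     ≡⟨ cong (λ x → (x + k % N) % N) (m%n%n≡m%n m N) ⟩
    (m % N + k % N) % N         ≡⟨ %-distribˡ-+ m k N ⟨
    (m + k) % N                 ∎
    where open ≡-Reasoning

  shift-shift : ∀ (i : Fin N) a b → shift (shift i a) b ≡ shift i (a + b)
  shift-shift i a b = toℕ-injective (begin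
    toℕ (shift (shift i a) b)   ≡⟨ toℕ-shift (shift i a) b ⟩
    (toℕ (shift i a) + b) % N   ≡⟨ cong (λ x → (x + b) % N) (toℕ-shift i a) ⟩
    ((toℕ i + a) % N + b) % N   ≡⟨ [m%n+k]%n≡[m+k]%n (toℕ i + a) b ⟩
    (toℕ i + a + b) % N         ≡⟨ cong (_% N) (+-assoc (toℕ i) a b) ⟩
    (toℕ i + (a + b)) % N       ≡⟨ toℕ-shift i (a + b) ⟨
    toℕ (shift i (a + b))       ∎)
    where open ≡-Reasoning

  shift-zero : ∀ (i : Fin N) → shift i 0 ≡ i
  shift-zero i = toℕ-injective (trans (toℕ-shift i 0)
                   (trans (cong (_% N) (+-identityʳ (toℕ i))) (m<n⇒m%n≡m (toℕ<n i))))

  shift-period : ∀ (i : Fin N) → shift i N ≡ i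
  shift-period i = toℕ-injective (trans (toℕ-shift i N)
                     (trans ([m+n]%n≡m%n (toℕ i) N) (m<n⇒m%n≡m (toℕ<n i))))

  succ pred : Fin N → Fin N
  succ i = shift i 1
  pred i = shift i n

  pred-succ : ∀ i → pred (succ i) ≡ i
  pred-succ i = trans (shift-shift i 1 n) (shift-period i)

  succ-pred : ∀ i → succ (pred i) ≡ i
  succ-pred i = trans (shift-shift i n 1) (trans (cong (shift i) (+-comm n 1)) (shift-period i))

  position : ℕ → Fin N
  position k = shift fzero k

  position-suc : ∀ k → position (suc k) ≡ succ (position k)
  position-suc k = trans (cong (shift fzero) (+-comm 1 k)) (sym (shift-shift fzero k 1))

  position-period : ∀ k → position (k + N) ≡ position k
  position-period k = trans (sym (shift-shift fzero k N)) (shift-period (position k))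

  position-toℕ : ∀ i → position (toℕ i) ≡ i
  position-toℕ i = toℕ-injective (trans (toℕ-shift fzero (toℕ i)) (m<n⇒m%n≡m (toℕ<n i)))

  Cyclic : (Fin N → Column) → Set
  Cyclic f = ∀ j → T (dominatedAt (f (pred j)) (f j) (f (succ j)))

  totalWeight : (Fin N → Column) → ℕ
  totalWeight f = sum (map (weight ∘ f) (allFin N))

  -- The states κ (g k) (g (k + 1)) of the unrolled sequence g form a closed walk of length N.
  cyclic-lower-bound : ∀ f → 5 ≤ N → Cyclic f → γ N ≤ totalWeight f
  cyclic-lower-bound f 5≤N cyclic =
    fin≤fin⁻¹ (≤∞-trans diagonal (subst (λ t → (Mt ^ N) ⟨ state 0 , state 0 ⟩ ≤∞ fin t) total closedWalk))
    where
    g : ℕ → Column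
    g = f ∘ position

    state : ℕ → Fin 20
    state k = κ (g k) (g (suc k))

    local : ∀ k → T (dominatedAt (g k) (g (suc k)) (g (suc (suc k))))
    local k = subst₂ (λ a c → T (dominatedAt (f a) (g (suc k)) (f c)))
                     (trans (cong pred (position-suc k)) (pred-succ (position k)))
                     (sym (position-suc (suc k)))
                     (cyclic (position (suc k)))

    walk : (Mt ^ N) ⟨ state 0 , state N ⟩ ≤∞ fin (sum (applyUpTo (weight ∘ g ∘ suc ∘ suc) N))
    walk = ^-≤-walk Mt state (weight ∘ g ∘ suc ∘ suc)
                    (λ k → κ-transition (g k) (g (suc k)) (g (suc (suc k))) (local k)) N

    closedWalk : (Mt ^ N) ⟨ state 0 , state 0 ⟩ ≤∞ fin (sum (applyUpTo (weight ∘ g ∘ suc ∘ suc) N))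
    closedWalk = subst (λ t → (Mt ^ N) ⟨ state 0 , t ⟩ ≤∞ fin (sum (applyUpTo (weight ∘ g ∘ suc ∘ suc) N)))
                       (cong₂ κ (cong f (position-period 0)) (cong f (position-period 1)))
                       walk

    total : sum (applyUpTo (weight ∘ g ∘ suc ∘ suc) N) ≡ totalWeight f
    total = begin
      sum (applyUpTo (weight ∘ g ∘ suc ∘ suc) N)
        ≡⟨ sum-applyUpTo-rotate (weight ∘ g ∘ suc) N (cong (weight ∘ f) (position-period 1)) ⟩
      sum (applyUpTo (weight ∘ g ∘ suc) N)
        ≡⟨ sum-applyUpTo-rotate (weight ∘ g) N (cong (weight ∘ f) (position-period 0)) ⟩
      sum (applyUpTo (weight ∘ g) N)
        ≡⟨ cong sum (map-tabulate≡applyUpTo (weight ∘ f) (λ i → i) (weight ∘ g) (cong (weight ∘ f) ∘ sym ∘ position-toℕ)) ⟨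
      totalWeight f
        ∎
      where open ≡-Reasoning

    diagonal : fin (γ N) ≤∞ (Mt ^ N) ⟨ state 0 , state 0 ⟩
    diagonal = subst (λ m → fin (γ m) ≤∞ (Mt ^ m) ⟨ state 0 , state 0 ⟩) (m+[n∸m]≡n 5≤N)
                     (Mt-diagonal (N ∸ 5) (state 0))

-- Cyclic words

blank : Column
blank = column false false false false false

-- Indexing with the junk value blank past the end.
at : List Column → ℕ → Column
at []       _       = blank
at (c ∷ cs) zero    = c
at (c ∷ cs) (suc m) = at cs m

at-++ˡ : ∀ xs {ys} {m} → m < length xs → at (xs ++ ys) m ≡ at xs m
at-++ˡ (x ∷ xs) {m = zero}  _        = refl
at-++ˡ (x ∷ xs) {m = suc m} (s≤s m<) = at-++ˡ xs m<

at-++ʳ : ∀ xs {ys} i → at (xs ++ ys) (length xs + i) ≡ at ys i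
at-++ʳ []       i = refl
at-++ʳ (x ∷ xs) i = at-++ʳ xs i

at-take-2 : ∀ xs i → i < 2 → at (take 2 xs) i ≡ at xs i
at-take-2 []           i             _ = refl
at-take-2 (a ∷ xs)     zero          _ = refl
at-take-2 (a ∷ [])     (suc i)       _ = refl
at-take-2 (a ∷ b ∷ xs) 1             _ = refl
at-take-2 (a ∷ b ∷ xs) (suc (suc i)) (s≤s (s≤s ()))

applyUpTo-at : ∀ xs → applyUpTo (at xs) (length xs) ≡ xs
applyUpTo-at []       = refl
applyUpTo-at (x ∷ xs) = cong (x ∷_) (applyUpTo-at xs)

chain : List Column → Bool
chain (a ∷ b ∷ c ∷ cs) = dominatedAt a b c ∧ chain (b ∷ c ∷ cs)
chain _                = true

chain-at : ∀ cs m → T (chain cs) → 2 + m < length cs →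
           T (dominatedAt (at cs m) (at cs (1 + m)) (at cs (2 + m)))
chain-at (a ∷ b ∷ c ∷ cs) zero    ch _          = proj₁ (Equivalence.to T-∧ ch)
chain-at (a ∷ b ∷ c ∷ cs) (suc m) ch (s≤s 2+m<) =
  chain-at (b ∷ c ∷ cs) m (proj₂ (Equivalence.to (T-∧ {dominatedAt a b c}) ch)) 2+m<
chain-at (a ∷ [])     zero    _ (s≤s ())
chain-at (a ∷ b ∷ []) zero    _ (s≤s (s≤s ()))
chain-at (a ∷ b ∷ []) (suc m) _ (s≤s (s≤s ()))

-- The cyclic windows of three consecutive columns of X are the windows of X ++ take 2 X.
module _ {n : ℕ} (X : List Column) (length-X : length X ≡ suc n) (2≤N : 2 ≤ suc n) where

  private
    N : ℕ
    N = suc n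
    Y : List Column
    Y = X ++ take 2 X

  wordColumns : Fin N → Column
  wordColumns j = at X (toℕ j)

  length-Y : length Y ≡ N + 2
  length-Y = begin
    length (X ++ take 2 X)           ≡⟨ length-++ X ⟩
    length X + length (take 2 X)     ≡⟨ cong₂ _+_ length-X (length-take 2 X) ⟩
    N + 2 ⊓ length X                 ≡⟨ cong (N +_) (m≤n⇒m⊓n≡m (subst (2 ≤_) (sym length-X) 2≤N)) ⟩
    N + 2                            ∎
    where open ≡-Reasoning

  at-cycle : ∀ m → m < N + 2 → at Y m ≡ at X (m % N)
  at-cycle m m< with m <? N
  ... | yes m<N = trans (at-++ˡ X (subst (m <_) (sym length-X) m<N)) (cong (at X) (sym (m<n⇒m%n≡m m<N)))
  ... | no m≮N = begin
      at Y m                ≡⟨ cong (at Y) N+i≡m ⟨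
      at Y (N + i)          ≡⟨ cong (λ L → at Y (L + i)) length-X ⟨
      at Y (length X + i)   ≡⟨ at-++ʳ X i ⟩
      at (take 2 X) i       ≡⟨ at-take-2 X i i<2 ⟩
      at X i                ≡⟨ cong (at X) m%N≡i ⟨
      at X (m % N)          ∎
    where
    open ≡-Reasoning
    i : ℕ
    i = m ∸ N
    N+i≡m : N + i ≡ m
    N+i≡m = m+[n∸m]≡n (≮⇒≥ m≮N)
    i<2 : i < 2
    i<2 = +-cancelˡ-< N i 2 (subst (_< N + 2) (sym N+i≡m) m<)
    m%N≡i : m % N ≡ i
    m%N≡i = begin
      m % N        ≡⟨ cong (_% N) (trans (sym N+i≡m) (+-comm N i)) ⟩
      (i + N) % N  ≡⟨ [m+n]%n≡m%n i N ⟩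
      i % N        ≡⟨ m<n⇒m%n≡m (≤-trans i<2 2≤N) ⟩
      i            ∎

  at-shift : ∀ i k → k ≤ 2 → wordColumns (shift i k) ≡ at Y (k + toℕ i)
  at-shift i k k≤2 = begin
    at X (toℕ (shift i k))    ≡⟨ cong (at X) (trans (toℕ-shift i k) (cong (_% N) (+-comm (toℕ i) k))) ⟩
    at X ((k + toℕ i) % N)    ≡⟨ at-cycle (k + toℕ i) (subst (_< N + 2) (+-comm (toℕ i) k) (+-mono-<-≤ (toℕ<n i) k≤2)) ⟨
    at Y (k + toℕ i)          ∎
    where open ≡-Reasoning

  word-cyclic : T (chain Y) → Cyclic wordColumns
  word-cyclic closed j =
    subst₂ (λ i i′ → T (dominatedAt (wordColumns (pred j)) (wordColumns i) (wordColumns i′)))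
           (succ-pred j) (trans (sym (shift-shift (pred j) 1 1)) (cong succ (succ-pred j)))
           (window (pred j))
    where
    window : ∀ i → T (dominatedAt (wordColumns i) (wordColumns (shift i 1)) (wordColumns (shift i 2)))
    window i =
      subst₂ (λ b c → T (dominatedAt (wordColumns i) b c)) (sym (at-shift i 1 (s≤s z≤n))) (sym (at-shift i 2 ≤-refl))
        (subst (λ a → T (dominatedAt a (at Y (1 + t)) (at Y (2 + t))))
               (trans (sym (at-shift i 0 z≤n)) (cong wordColumns (shift-zero i)))
               (chain-at Y t closed (subst (2 + t <_) (sym length-Y)
                                           (subst (_< N + 2) (+-comm t 2) (+-monoˡ-< 2 (toℕ<n i))))))
      where
      t : ℕ
      t = toℕ i

-- Optimal arrangements

only : Kind → Column
only V     = column true  false false false false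
only U     = column false true  false false false
only Spoke = column false false true  false false
only Outer = column false false false true  false
only Inner = column false false false false true

vAndInner : Column
vAndInner = column true false false false true

-- Weight 6, and it ends with the two columns blank and only V that start every cyclic word
-- below, so the chain test restarts after each block (chain-blocks).
block : List Column
block = only Inner ∷ only Outer ∷ blank ∷ only U ∷ only Outer ∷ only Inner ∷ blank ∷ only V ∷ []

blocks : ℕ → List Column
blocks zero    = []
blocks (suc k) = block ++ blocks k

ending : ℕ → List Column
ending 0 = only Inner ∷ only Outer ∷ blank ∷ only U ∷ only Outer ∷ only Inner ∷ []
ending 1 = only Inner ∷ only Outer ∷ blank ∷ only U ∷ only Spoke ∷ only V ∷ vAndInner ∷ []
ending 2 = only Inner ∷ only Outer ∷ blank ∷ only U ∷ only Outer ∷ only Inner ∷ blank ∷ vAndInner ∷ []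
ending 3 = block ++ vAndInner ∷ []
ending 4 = block ++ only U ∷ vAndInner ∷ []
ending 5 = block ++ only U ∷ only Outer ∷ only Inner ∷ []
ending 6 = block ++ only Spoke ∷ only U ∷ only Outer ∷ only Inner ∷ []
ending _ = block ++ only Inner ∷ only Outer ∷ blank ∷ only U ∷ vAndInner ∷ []

cyclicWord : ℕ → ℕ → List Column
cyclicWord k r = blank ∷ only V ∷ blocks k ++ ending r

wordWeight : List Column → ℕ
wordWeight = sum ∘ map weight

chain-blocks : ∀ k rest → chain (blank ∷ only V ∷ blocks k ++ rest) ≡ chain (blank ∷ only V ∷ rest)
chain-blocks zero    rest = refl
chain-blocks (suc k) rest = chain-blocks k rest

length-blocks : ∀ k rest → length (blocks k ++ rest) ≡ 8 * k + length rest
length-blocks zero    rest = refl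
length-blocks (suc k) rest = trans (cong (8 +_) (length-blocks k rest))
                                   (trans (sym (+-assoc 8 (8 * k) _)) (cong (_+ length rest) (sym (*-suc 8 k))))

wordWeight-blocks : ∀ k rest → wordWeight (blocks k ++ rest) ≡ 6 * k + wordWeight rest
wordWeight-blocks zero    rest = refl
wordWeight-blocks (suc k) rest = trans (cong (6 +_) (wordWeight-blocks k rest))
                                       (trans (sym (+-assoc 6 (6 * k) _)) (cong (_+ wordWeight rest) (sym (*-suc 6 k))))

ending-correct : ∀ r → r < 8 → T (chain (blank ∷ only V ∷ ending r ++ blank ∷ only V ∷ []))
                             × length (ending r) ≡ 6 + r
                             × suc (wordWeight (ending r)) ≡ formula 1 r
ending-correct 0 _ = _ , refl , refl
ending-correct 1 _ = _ , refl , refl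
ending-correct 2 _ = _ , refl , refl
ending-correct 3 _ = _ , refl , refl
ending-correct 4 _ = _ , refl , refl
ending-correct 5 _ = _ , refl , refl
ending-correct 6 _ = _ , refl , refl
ending-correct 7 _ = _ , refl , refl
ending-correct (suc (suc (suc (suc (suc (suc (suc (suc _)))))))) (s≤s (s≤s (s≤s (s≤s (s≤s (s≤s (s≤s (s≤s ()))))))))

formula-lin : ∀ k r → formula (suc k) r ≡ 6 * k + formula 1 r
formula-lin zero    r = refl
formula-lin (suc k) r = begin
  formula (suc (suc k)) r        ≡⟨ formula-suc (suc k) r ⟩
  6 + formula (suc k) r          ≡⟨ cong (6 +_) (formula-lin k r) ⟩
  6 + (6 * k + formula 1 r)      ≡⟨ +-assoc 6 (6 * k) _ ⟨
  6 + 6 * k + formula 1 r        ≡⟨ cong (_+ formula 1 r) (*-suc 6 k) ⟨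
  6 * suc k + formula 1 r        ∎
  where open ≡-Reasoning

word-arrangement : ∀ {n} k r → r < 8 → suc n ≡ r + suc k * 8 →
                   Σ (Fin (suc n) → Column) λ f → Cyclic f × totalWeight f ≡ formula (suc k) r
word-arrangement {n} k r r<8 N≡ = wordColumns X length-X 2≤N , word-cyclic X length-X 2≤N closed , total
  where
  open ≡-Reasoning
  X : List Column
  X = cyclicWord k r
  closed-ending : T (chain (blank ∷ only V ∷ ending r ++ blank ∷ only V ∷ []))
  closed-ending = proj₁ (ending-correct r r<8)
  length-ending : length (ending r) ≡ 6 + r
  length-ending = proj₁ (proj₂ (ending-correct r r<8))
  weight-ending : suc (wordWeight (ending r)) ≡ formula 1 r
  weight-ending = proj₂ (proj₂ (ending-correct r r<8))

  rearrange : ∀ k r → 2 + (8 * k + (6 + r)) ≡ r + suc k * 8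
  rearrange = solve-∀

  length-X : length X ≡ suc n
  length-X = begin
    2 + length (blocks k ++ ending r)   ≡⟨ cong (2 +_) (length-blocks k (ending r)) ⟩
    2 + (8 * k + length (ending r))     ≡⟨ cong (λ l → 2 + (8 * k + l)) length-ending ⟩
    2 + (8 * k + (6 + r))               ≡⟨ rearrange k r ⟩
    r + suc k * 8                       ≡⟨ N≡ ⟨
    suc n                               ∎

  2≤N : 2 ≤ suc n
  2≤N = subst (2 ≤_) length-X (s≤s (s≤s z≤n))

  closed : T (chain (X ++ take 2 X))
  closed = subst T (sym (trans (cong (λ w → chain (blank ∷ only V ∷ w)) (++-assoc (blocks k) (ending r) _))
                               (chain-blocks k _)))
                 closed-ending

  total : totalWeight (wordColumns X length-X 2≤N) ≡ formula (suc k) r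
  total = begin
    sum (map (weight ∘ wordColumns X length-X 2≤N) (allFin (suc n)))
      ≡⟨ cong sum (map-tabulate≡applyUpTo (weight ∘ wordColumns X length-X 2≤N) (λ i → i) (weight ∘ at X) (λ i → refl)) ⟩
    sum (applyUpTo (weight ∘ at X) (suc n))
      ≡⟨ cong (λ l → sum (applyUpTo (weight ∘ at X) l)) length-X ⟨
    sum (applyUpTo (weight ∘ at X) (length X))
      ≡⟨ cong sum (trans (sym (map-applyUpTo (at X) weight (length X))) (cong (map weight) (applyUpTo-at X))) ⟩
    wordWeight X
      ≡⟨ cong suc (wordWeight-blocks k (ending r)) ⟩
    suc (6 * k + wordWeight (ending r))
      ≡⟨ +-suc (6 * k) _ ⟨
    6 * k + suc (wordWeight (ending r))
      ≡⟨ cong (6 * k +_) weight-ending ⟩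
    6 * k + formula 1 r
      ≡⟨ formula-lin k r ⟨
    formula (suc k) r
      ∎

upper-arrangement : ∀ {n} → 8 ≤ suc n → Σ (Fin (suc n) → Column) λ f → Cyclic f × totalWeight f ≡ γ (suc n)
upper-arrangement {n} 8≤N
  with suc n / 8 | suc n % 8 | m≡m%n+[m/n]*n (suc n) 8 | m%n<n (suc n) 8 | m≥n⇒m/n>0 {suc n} {8} 8≤N
... | suc k | r | N≡ | r<8 | _ = word-arrangement k r r<8 N≡

-- From columns to sets of vertices and edges

length-filterᵇ : ∀ {A : Set} (p : A → Bool) xs → length (filterᵇ p xs) ≡ sum (map (indicator ∘ p) xs)
length-filterᵇ p []       = refl
length-filterᵇ p (x ∷ xs) with p x
... | true  = cong suc (length-filterᵇ p xs)
... | false = length-filterᵇ p xs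

sum-map-cartesianProductWith : ∀ {A B C : Set} (g : C → ℕ) (f : A → B → C) xs ys →
  sum (map g (cartesianProductWith f xs ys)) ≡ sum (map (λ x → sum (map g (map (f x) ys))) xs)
sum-map-cartesianProductWith g f []       ys = refl
sum-map-cartesianProductWith g f (x ∷ xs) ys = begin
  sum (map g (map (f x) ys ++ cartesianProductWith f xs ys))
    ≡⟨ cong sum (map-++ g (map (f x) ys) _) ⟩
  sum (map g (map (f x) ys) ++ map g (cartesianProductWith f xs ys))
    ≡⟨ sum-++ (map g (map (f x) ys)) _ ⟩
  sum (map g (map (f x) ys)) + sum (map g (cartesianProductWith f xs ys))
    ≡⟨ cong (sum (map g (map (f x) ys)) +_) (sum-map-cartesianProductWith g f xs ys) ⟩
  sum (map g (map (f x) ys)) + sum (map (λ x → sum (map g (map (f x) ys))) xs)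
    ∎
  where open ≡-Reasoning

module _ {n : ℕ} where

  private
    N : ℕ
    N = suc n
    G : Graph
    G = Petersen N 1

  Element : Set
  Element = Elem G

  elem : Kind → Fin N → Element
  elem V     j = inj₁ (v j)
  elem U     j = inj₁ (u j)
  elem Spoke j = inj₂ (spoke j)
  elem Outer j = inj₂ (outer j)
  elem Inner j = inj₂ (inner j)

  kindOf : Element → Kind
  kindOf (inj₁ (v _))     = V
  kindOf (inj₁ (u _))     = U
  kindOf (inj₂ (spoke _)) = Spoke
  kindOf (inj₂ (outer _)) = Outer
  kindOf (inj₂ (inner _)) = Inner

  indexOf : Element → Fin N
  indexOf (inj₁ (v j))     = j
  indexOf (inj₁ (u j))     = j
  indexOf (inj₂ (spoke j)) = j
  indexOf (inj₂ (outer j)) = j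
  indexOf (inj₂ (inner j)) = j

  elem-kindOf-indexOf : ∀ x → elem (kindOf x) (indexOf x) ≡ x
  elem-kindOf-indexOf (inj₁ (v _))     = refl
  elem-kindOf-indexOf (inj₁ (u _))     = refl
  elem-kindOf-indexOf (inj₂ (spoke _)) = refl
  elem-kindOf-indexOf (inj₂ (outer _)) = refl
  elem-kindOf-indexOf (inj₂ (inner _)) = refl

  kindOf-indexOf-elem : ∀ k j → kindOf (elem k j) ≡ k × indexOf (elem k j) ≡ j
  kindOf-indexOf-elem V     j = refl , refl
  kindOf-indexOf-elem U     j = refl , refl
  kindOf-indexOf-elem Spoke j = refl , refl
  kindOf-indexOf-elem Outer j = refl , refl
  kindOf-indexOf-elem Inner j = refl , refl

  elem-injective : ∀ {j j′ k k′} → elem k j ≡ elem k′ j′ → j ≡ j′ × k ≡ k′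
  elem-injective {j} {j′} {k} {k′} eq =
    trans (sym (proj₂ (kindOf-indexOf-elem k j))) (trans (cong indexOf eq) (proj₂ (kindOf-indexOf-elem k′ j′))) ,
    trans (sym (proj₁ (kindOf-indexOf-elem k j))) (trans (cong kindOf eq) (proj₁ (kindOf-indexOf-elem k′ j′)))

  _≟ⱽ_ : DecidableEquality (PVertex N)
  v i ≟ⱽ v j = map′ (cong v) (λ { refl → refl }) (i ≟ᶠ j)
  v i ≟ⱽ u j = no λ ()
  u i ≟ⱽ v j = no λ ()
  u i ≟ⱽ u j = map′ (cong u) (λ { refl → refl }) (i ≟ᶠ j)

  _≟ᴱ_ : DecidableEquality (PEdge N)
  outer i ≟ᴱ outer j = map′ (cong outer) (λ { refl → refl }) (i ≟ᶠ j)
  outer i ≟ᴱ spoke j = no λ ()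
  outer i ≟ᴱ inner j = no λ ()
  spoke i ≟ᴱ outer j = no λ ()
  spoke i ≟ᴱ spoke j = map′ (cong spoke) (λ { refl → refl }) (i ≟ᶠ j)
  spoke i ≟ᴱ inner j = no λ ()
  inner i ≟ᴱ outer j = no λ ()
  inner i ≟ᴱ spoke j = no λ ()
  inner i ≟ᴱ inner j = map′ (cong inner) (λ { refl → refl }) (i ≟ᶠ j)

  _≟ᵉ_ : DecidableEquality Element
  _≟ᵉ_ = ≡-dec _≟ⱽ_ _≟ᴱ_

  pos : Fin N → Offset → Fin N
  pos j left  = pred j
  pos j mid   = j
  pos j right = succ j

  Near : Kind → Fin N → Element → Set
  Near k j y = Any (λ (o , k′) → y ≡ elem k′ (pos j o)) (neighbourhood k)

  private
    entry : ∀ {xs} {P : Offset × Kind → Set} (i : Fin (length xs)) → P (lookup xs i) → Any P xs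
    entry i = lose (∈-lookup i)

    left-of : ∀ (i : Fin N) → i ≡ pred (succ i)
    left-of i = sym (pred-succ i)

    succ-injective : ∀ {i j} → succ i ≡ succ j → i ≡ j
    succ-injective {i} {j} eq = trans (left-of i) (trans (cong pred eq) (pred-succ j))

    v-injective : ∀ {i j : Fin N} → v i ≡ v j → i ≡ j
    v-injective refl = refl

    u-injective : ∀ {i j : Fin N} → u i ≡ u j → i ≡ j
    u-injective refl = refl

  related-v⇒near : ∀ j y → Related G y (inj₁ (v j)) → Near V j y
  related-v⇒near j (inj₁ _) (outer i , inj₁ (refl , refl)) = entry (# 1) (cong (inj₁ ∘ v) (left-of i))
  related-v⇒near j (inj₁ _) (outer i , inj₂ (refl , refl)) = entry (# 2) refl
  related-v⇒near j (inj₁ _) (spoke i , inj₁ (refl , ()))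
  related-v⇒near j (inj₁ _) (spoke i , inj₂ (refl , refl)) = entry (# 3) refl
  related-v⇒near j (inj₁ _) (inner i , inj₁ (refl , ()))
  related-v⇒near j (inj₁ _) (inner i , inj₂ (() , _))
  related-v⇒near j (inj₂ (outer i)) (inj₁ refl) = entry (# 5) refl
  related-v⇒near j (inj₂ (outer i)) (inj₂ refl) = entry (# 4) (cong (inj₂ ∘ outer) (left-of i))
  related-v⇒near j (inj₂ (spoke i)) (inj₁ refl) = entry (# 6) refl
  related-v⇒near j (inj₂ (spoke i)) (inj₂ ())
  related-v⇒near j (inj₂ (inner i)) (inj₁ ())
  related-v⇒near j (inj₂ (inner i)) (inj₂ ())

  related-u⇒near : ∀ j y → Related G y (inj₁ (u j)) → Near U j y
  related-u⇒near j (inj₁ _) (outer i , inj₁ (refl , ()))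
  related-u⇒near j (inj₁ _) (outer i , inj₂ (() , _))
  related-u⇒near j (inj₁ _) (spoke i , inj₁ (refl , refl)) = entry (# 3) refl
  related-u⇒near j (inj₁ _) (spoke i , inj₂ (() , _))
  related-u⇒near j (inj₁ _) (inner i , inj₁ (refl , refl)) = entry (# 1) (cong (inj₁ ∘ u) (left-of i))
  related-u⇒near j (inj₁ _) (inner i , inj₂ (refl , refl)) = entry (# 2) refl
  related-u⇒near j (inj₂ (outer i)) (inj₁ ())
  related-u⇒near j (inj₂ (outer i)) (inj₂ ())
  related-u⇒near j (inj₂ (spoke i)) (inj₁ ())
  related-u⇒near j (inj₂ (spoke i)) (inj₂ refl) = entry (# 6) refl
  related-u⇒near j (inj₂ (inner i)) (inj₁ refl) = entry (# 5) refl
  related-u⇒near j (inj₂ (inner i)) (inj₂ refl) = entry (# 4) (cong (inj₂ ∘ inner) (left-of i))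

  related-spoke⇒near : ∀ j y → Related G y (inj₂ (spoke j)) → Near Spoke j y
  related-spoke⇒near j (inj₁ _) (inj₁ refl) = entry (# 1) refl
  related-spoke⇒near j (inj₁ _) (inj₂ refl) = entry (# 2) refl
  related-spoke⇒near j (inj₂ (outer i)) (_ , inj₁ refl , inj₁ refl) = entry (# 4) refl
  related-spoke⇒near j (inj₂ (outer i)) (_ , inj₂ refl , inj₁ refl) = entry (# 3) (cong (inj₂ ∘ outer) (left-of i))
  related-spoke⇒near j (inj₂ (spoke i)) (_ , inj₁ refl , inj₁ refl) = entry (# 0) refl
  related-spoke⇒near j (inj₂ (spoke i)) (_ , inj₂ refl , inj₂ refl) = entry (# 0) refl
  related-spoke⇒near j (inj₂ (inner i)) (_ , inj₁ () , inj₁ refl)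
  related-spoke⇒near j (inj₂ (inner i)) (_ , inj₂ () , inj₁ refl)
  related-spoke⇒near j (inj₂ (inner i)) (_ , inj₁ refl , inj₂ refl) = entry (# 6) refl
  related-spoke⇒near j (inj₂ (inner i)) (_ , inj₂ refl , inj₂ refl) = entry (# 5) (cong (inj₂ ∘ inner) (left-of i))

  related-outer⇒near : ∀ j y → Related G y (inj₂ (outer j)) → Near Outer j y
  related-outer⇒near j (inj₁ _) (inj₁ refl) = entry (# 1) refl
  related-outer⇒near j (inj₁ _) (inj₂ refl) = entry (# 2) refl
  related-outer⇒near j (inj₂ (outer i)) (_ , inj₁ refl , inj₁ refl) = entry (# 0) refl
  related-outer⇒near j (inj₂ (outer i)) (_ , inj₂ refl , inj₁ refl) = entry (# 3) (cong (inj₂ ∘ outer) (left-of i))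
  related-outer⇒near j (inj₂ (outer i)) (_ , inj₁ refl , inj₂ refl) = entry (# 4) refl
  related-outer⇒near j (inj₂ (outer i)) (_ , inj₂ e , inj₂ e′) =
    entry (# 0) (cong (inj₂ ∘ outer) (succ-injective (v-injective (trans e (sym e′)))))
  related-outer⇒near j (inj₂ (spoke i)) (_ , inj₁ refl , inj₁ refl) = entry (# 5) refl
  related-outer⇒near j (inj₂ (spoke i)) (_ , inj₂ () , inj₁ refl)
  related-outer⇒near j (inj₂ (spoke i)) (_ , inj₁ refl , inj₂ refl) = entry (# 6) refl
  related-outer⇒near j (inj₂ (spoke i)) (_ , inj₂ () , inj₂ refl)
  related-outer⇒near j (inj₂ (inner i)) (_ , inj₁ () , inj₁ refl)
  related-outer⇒near j (inj₂ (inner i)) (_ , inj₂ () , inj₁ refl)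
  related-outer⇒near j (inj₂ (inner i)) (_ , inj₁ () , inj₂ refl)
  related-outer⇒near j (inj₂ (inner i)) (_ , inj₂ () , inj₂ refl)

  related-inner⇒near : ∀ j y → Related G y (inj₂ (inner j)) → Near Inner j y
  related-inner⇒near j (inj₁ _) (inj₁ refl) = entry (# 1) refl
  related-inner⇒near j (inj₁ _) (inj₂ refl) = entry (# 2) refl
  related-inner⇒near j (inj₂ (outer i)) (_ , inj₁ () , inj₁ refl)
  related-inner⇒near j (inj₂ (outer i)) (_ , inj₂ () , inj₁ refl)
  related-inner⇒near j (inj₂ (outer i)) (_ , inj₁ () , inj₂ refl)
  related-inner⇒near j (inj₂ (outer i)) (_ , inj₂ () , inj₂ refl)
  related-inner⇒near j (inj₂ (spoke i)) (_ , inj₁ () , inj₁ refl)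
  related-inner⇒near j (inj₂ (spoke i)) (_ , inj₂ refl , inj₁ refl) = entry (# 5) refl
  related-inner⇒near j (inj₂ (spoke i)) (_ , inj₁ () , inj₂ refl)
  related-inner⇒near j (inj₂ (spoke i)) (_ , inj₂ refl , inj₂ refl) = entry (# 6) refl
  related-inner⇒near j (inj₂ (inner i)) (_ , inj₁ refl , inj₁ refl) = entry (# 0) refl
  related-inner⇒near j (inj₂ (inner i)) (_ , inj₂ refl , inj₁ refl) = entry (# 3) (cong (inj₂ ∘ inner) (left-of i))
  related-inner⇒near j (inj₂ (inner i)) (_ , inj₁ refl , inj₂ refl) = entry (# 4) refl
  related-inner⇒near j (inj₂ (inner i)) (_ , inj₂ e , inj₂ e′) =
    entry (# 0) (cong (inj₂ ∘ inner) (succ-injective (u-injective (trans e (sym e′)))))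

  related⇒near : ∀ k j y → Related G y (elem k j) → Near k j y
  related⇒near V     = related-v⇒near
  related⇒near U     = related-u⇒near
  related⇒near Spoke = related-spoke⇒near
  related⇒near Outer = related-outer⇒near
  related⇒near Inner = related-inner⇒near

  Dominates : Kind → Fin N → Offset × Kind → Set
  Dominates k j (o , k′) = elem k′ (pos j o) ≡ elem k j ⊎ Related G (elem k′ (pos j o)) (elem k j)

  near⇒related : ∀ k j → All (Dominates k j) (neighbourhood k)
  near⇒related V j =
    inj₁ refl ∷ inj₂ (outer (pred j) , inj₁ (refl , cong v (succ-pred j))) ∷ inj₂ (outer j , inj₂ (refl , refl)) ∷
    inj₂ (spoke j , inj₂ (refl , refl)) ∷ inj₂ (inj₂ (cong v (succ-pred j))) ∷ inj₂ (inj₁ refl) ∷ inj₂ (inj₁ refl) ∷ []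
  near⇒related U j =
    inj₁ refl ∷ inj₂ (inner (pred j) , inj₁ (refl , cong u (succ-pred j))) ∷ inj₂ (inner j , inj₂ (refl , refl)) ∷
    inj₂ (spoke j , inj₁ (refl , refl)) ∷ inj₂ (inj₂ (cong u (succ-pred j))) ∷ inj₂ (inj₁ refl) ∷ inj₂ (inj₂ refl) ∷ []
  near⇒related Spoke j =
    inj₁ refl ∷ inj₂ (inj₁ refl) ∷ inj₂ (inj₂ refl) ∷
    inj₂ (v j , inj₂ (cong v (succ-pred j)) , inj₁ refl) ∷ inj₂ (v j , inj₁ refl , inj₁ refl) ∷
    inj₂ (u j , inj₂ (cong u (succ-pred j)) , inj₂ refl) ∷ inj₂ (u j , inj₁ refl , inj₂ refl) ∷ []
  near⇒related Outer j =
    inj₁ refl ∷ inj₂ (inj₁ refl) ∷ inj₂ (inj₂ refl) ∷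
    inj₂ (v j , inj₂ (cong v (succ-pred j)) , inj₁ refl) ∷ inj₂ (v (succ j) , inj₁ refl , inj₂ refl) ∷
    inj₂ (v j , inj₁ refl , inj₁ refl) ∷ inj₂ (v (succ j) , inj₁ refl , inj₂ refl) ∷ []
  near⇒related Inner j =
    inj₁ refl ∷ inj₂ (inj₁ refl) ∷ inj₂ (inj₂ refl) ∷
    inj₂ (u j , inj₂ (cong u (succ-pred j)) , inj₁ refl) ∷ inj₂ (u (succ j) , inj₁ refl , inj₂ refl) ∷
    inj₂ (u j , inj₂ refl , inj₁ refl) ∷ inj₂ (u (succ j) , inj₂ refl , inj₂ refl) ∷ []

  pick-pos : ∀ (f : Fin N → Column) j o → pick (f (pred j)) (f j) (f (succ j)) o ≡ f (pos j o)
  pick-pos f j left  = refl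
  pick-pos f j mid   = refl
  pick-pos f j right = refl

  elements : List Element
  elements = cartesianProductWith (λ j k → elem k j) (allFin N) kinds

  ∈-elements : ∀ x → x ∈ elements
  ∈-elements x = subst (_∈ elements) (elem-kindOf-indexOf x)
                   (∈-cartesianProductWith⁺ (λ j k → elem k j) (∈-allFin (indexOf x)) (kind∈kinds (kindOf x)))

  elements-unique : Unique elements
  elements-unique = cartesianProductWith⁺ (λ j k → elem k j) elem-injective (allFin⁺ N) kinds-unique

  columnOf : (Element → Bool) → Fin N → Column
  columnOf p j = column (p (elem V j)) (p (elem U j)) (p (elem Spoke j)) (p (elem Outer j)) (p (elem Inner j))

  bit-columnOf : ∀ p j k → bit (columnOf p j) k ≡ p (elem k j)
  bit-columnOf p j V     = refl
  bit-columnOf p j U     = refl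
  bit-columnOf p j Spoke = refl
  bit-columnOf p j Outer = refl
  bit-columnOf p j Inner = refl

  length-filterᵇ-elements : ∀ p → length (filterᵇ p elements) ≡ totalWeight (columnOf p)
  length-filterᵇ-elements p = trans (length-filterᵇ p elements)
    (sum-map-cartesianProductWith (indicator ∘ p) (λ j k → elem k j) (allFin N) kinds)

  selected : (Fin N → Column) → Element → Bool
  selected f x = bit (f (indexOf x)) (kindOf x)

  selected-elem : ∀ f k j → selected f (elem k j) ≡ bit (f j) k
  selected-elem f k j = cong₂ (λ i k → bit (f i) k) (proj₂ (kindOf-indexOf-elem k j)) (proj₁ (kindOf-indexOf-elem k j))

  selection : (Fin N → Column) → List Element
  selection f = filterᵇ (selected f) elements

  selection-unique : ∀ f → Unique (selection f)
  selection-unique f = filter⁺ (T? ∘ selected f) elements-unique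

  length-selection : ∀ f → length (selection f) ≡ totalWeight f
  length-selection f = length-filterᵇ-elements (selected f)

  marked⇒selected : ∀ f j w → T (marked (f (pred j)) (f j) (f (succ j)) w) →
                    elem (proj₂ w) (pos j (proj₁ w)) ∈ selection f
  marked⇒selected f j (o , k) m = ∈-filter⁺ (T? ∘ selected f) (∈-elements (elem k (pos j o)))
    (subst T (sym (trans (selected-elem f k (pos j o)) (cong (λ c → bit c k) (sym (pick-pos f j o))))) m)

  cyclic⇒dominating : ∀ f → Cyclic f → IsMixedDominating G (selection f)
  cyclic⇒dominating f cyclic x =
    subst (λ x → x ∈ selection f ⊎ ∃ λ y → y ∈ selection f × Related G y x) (elem-kindOf-indexOf x)
          (dominated (kindOf x) (indexOf x))
    where
    dominated : ∀ k j → elem k j ∈ selection f ⊎ ∃ λ y → y ∈ selection f × Related G y (elem k j)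
    dominated k j = conclude _ (All.lookupAny (near⇒related k j) (any⁻ (marked a b c) (neighbourhood k) covered))
      where
      a b c : Column
      a = f (pred j)
      b = f j
      c = f (succ j)
      covered : T (any (marked a b c) (neighbourhood k))
      covered = All.lookup (all⁺ (λ k → any (marked a b c) (neighbourhood k)) kinds (cyclic j)) (kind∈kinds k)
      conclude : ∀ w → Dominates k j w × T (marked a b c w) →
                 elem k j ∈ selection f ⊎ ∃ λ y → y ∈ selection f × Related G y (elem k j)
      conclude w (inj₁ same , m) = inj₁ (subst (_∈ selection f) same (marked⇒selected f j w m))
      conclude w (inj₂ rel  , m) = inj₂ (_ , marked⇒selected f j w m , rel)

  memberOf : List Element → Element → Bool
  memberOf S x = isYes (member? _≟ᵉ_ x S)

  dominating⇒cyclic : ∀ S → IsMixedDominating G S → Cyclic (columnOf (memberOf S))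
  dominating⇒cyclic S dom j =
    all⁻ (λ k → any (marked a b c) (neighbourhood k))
         (All.tabulate {xs = kinds} λ {k} _ → any⁺ (marked a b c) (Any.map (present⇒marked _) (near k)))
    where
    columns : Fin N → Column
    columns = columnOf (memberOf S)
    a b c : Column
    a = columns (pred j)
    b = columns j
    c = columns (succ j)

    Present : Offset × Kind → Set
    Present (o , k) = elem k (pos j o) ∈ S

    near : ∀ k → Any Present (neighbourhood k)
    near k with dom (elem k j)
    ... | inj₁ x∈S              = lose (mid∈neighbourhood k) x∈S
    ... | inj₂ (y , y∈S , rel) = Any.map (λ y≡ → subst (_∈ S) y≡ y∈S) (related⇒near k j y rel)

    present⇒marked : ∀ w → Present w → T (marked a b c w)
    present⇒marked (o , k) x∈S =
      subst T (sym (trans (cong (λ c → bit c k) (pick-pos columns j o)) (bit-columnOf (memberOf S) (pos j o) k)))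
            (fromWitness {a? = member? _≟ᵉ_ (elem k (pos j o)) S} x∈S)

  length-unique : ∀ S → Unique S → length S ≡ totalWeight (columnOf (memberOf S))
  length-unique S unique =
    trans (sym (↭-length (∼bag⇒↭ (unique∧set⇒bag (filter⁺ (T? ∘ memberOf S) elements-unique) unique same))))
          (length-filterᵇ-elements (memberOf S))
    where
    same : ∀ {x} → x ∈ filterᵇ (memberOf S) elements ⇔ x ∈ S
    same {x} = mk⇔ (λ x∈ → toWitness (proj₂ (∈-filter⁻ (T? ∘ memberOf S) {x} x∈)))
               (λ x∈S → ∈-filter⁺ (T? ∘ memberOf S) (∈-elements x) (fromWitness {a? = member? _≟ᵉ_ x S} x∈S))

  dominating-size : 5 ≤ N → ∀ S → Unique S → IsMixedDominating G S → γ N ≤ length S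
  dominating-size 5≤N S unique dominating =
    ≤-trans (cyclic-lower-bound (columnOf (memberOf S)) 5≤N (dominating⇒cyclic S dominating))
            (≤-reflexive (sym (length-unique S unique)))

  optimal-dominating-set : 8 ≤ N → ∃ λ S → Unique S × IsMixedDominating G S × length S ≡ γ N
  optimal-dominating-set 8≤N with upper-arrangement 8≤N
  ... | f , cyclic , total =
    selection f , selection-unique f , cyclic⇒dominating f cyclic , trans (length-selection f) total

theorem1 : (n : ℕ) → 8 ≤ n →
    IsMixedDominationNumber (Petersen n 1) (formula (n / 8) (n % 8))
theorem1 (suc n) 8≤N =
  optimal-dominating-set 8≤N , dominating-size (≤-trans (m≤m+n 5 3) 8≤N)
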